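{- Let $m$ be a positive integer, $q=2^m$, and let $F\colon\mathbb{F}_2^m\to\mathbb{F}_2^m$ be an APN function. For $r\ge 1$ let $T_r(F)$ be the number of tuples $(x_1,\dots,x_r)\in(\mathbb{F}_2^m)^r$ with $x_1+\cdots+x_r=0$ and $F(x_1)+\cdots+F(x_r)=0$ such that $x_1,\dots,x_r$ are not pairwise distinct. Then $$T_4(F)=3q^2-2q,\qquad T_6(F)=q+15q(q-1)+15q(q-1)(q-2).$$
   Context: $F\colon\mathbb{F}_2^m\to\mathbb{F}_2^m$ is APN if for every $u\neq 0$ and every $v$, the equation $F(x+u)+F(x)=v$ has at most $2$ solutions $x\in\mathbb{F}_2^m$. -}

module Defs where

open import Data.Bool using (Bool; true; false; _xor_)
open import Data.Bool.Properties using () renaming (_≟_ to _≟ᵇ_)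
open import Data.Nat using (ℕ; zero; suc; _≤_)
open import Data.List using (List; []; _∷_; length; filter; concatMap; map)
open import Data.Vec using (Vec; []; _∷_; zipWith; replicate; foldr)
open import Data.Vec.Properties using (≡-dec)
open import Data.Vec.Relation.Unary.AllPairs using (AllPairs; allPairs?)
open import Data.Product using (_×_)
open import Relation.Nullary using (¬_; Dec; ¬?)
open import Relation.Nullary.Decidable using (_×-dec_)
open import Relation.Binary.PropositionalEquality using (_≡_; _≢_)
import Agda.Primitive
open import Relation.Unary using (Pred; Decidable)

-- The vector space 𝔽₂^m, realised as bit vectors of length m,
-- with addition = componentwise xor.
V : ℕ → Set
V m = Vec Bool m

_⊕_ : ∀ {m} → V m → V m → V m
_⊕_ = zipWith _xor_

infixl 6 _⊕_

𝟎 : ∀ {m} → V m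
𝟎 = replicate _ false

_≟V_ : ∀ {m} (x y : V m) → Dec (x ≡ y)
_≟V_ = ≡-dec _≟ᵇ_

allVecs : ∀ {A : Set} → List A → (n : ℕ) → List (Vec A n)
allVecs as zero    = [] ∷ []
allVecs as (suc n) = concatMap (λ a → map (a ∷_) (allVecs as n)) as

allV : (m : ℕ) → List (V m)
allV m = allVecs (false ∷ true ∷ []) m

count : ∀ {A : Set} {P : Pred A Agda.Primitive.lzero} → Decidable P → List A → ℕ
count P? xs = length (filter P? xs)

IsAPN : ∀ {m} → (V m → V m) → Set
IsAPN {m} F = ∀ (u v : V m) → u ≢ 𝟎 →
  count (λ x → (F (x ⊕ u) ⊕ F x) ≟V v) (allV m) ≤ 2

vsum : ∀ {m r} → Vec (V m) r → V m
vsum = foldr _ _⊕_ 𝟎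

PairwiseDistinct : ∀ {m r} → Vec (V m) r → Set
PairwiseDistinct = AllPairs _≢_

pairwiseDistinct? : ∀ {m r} → Decidable (PairwiseDistinct {m} {r})
pairwiseDistinct? = allPairs? (λ x y → ¬? (x ≟V y))

TCond : ∀ {m r} → (V m → V m) → Vec (V m) r → Set
TCond F xs = (vsum xs ≡ 𝟎) × (vsum (Data.Vec.map F xs) ≡ 𝟎) × ¬ PairwiseDistinct xs

TCond? : ∀ {m r} (F : V m → V m) → Decidable (TCond {m} {r} F)
TCond? F xs = (vsum xs ≟V 𝟎) ×-dec ((vsum (Data.Vec.map F xs) ≟V 𝟎) ×-dec ¬? (pairwiseDistinct? xs))

T : ∀ {m} → ℕ → (V m → V m) → ℕ
T {m} r F = count (TCond? F) (allVecs (allV m) r)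

{-# OPTIONS --safe #-}

-- Dropping a repeated pair from a tuple changes none of its sums in a Boolean group: neither
-- Σ x and Σ F(x) in 𝔽₂^m nor, in Bool, the parity of the multiplicity of any value.  For r = 4
-- what remains is a pair with zero sum, i.e. a repeated value.  For r = 6 what remains is a
-- quadruple with Σ x = Σ F(x) = 0; were its entries distinct, u = x₁ + x₂ = x₃ + x₄ would make
-- all four of them solutions of F(x + u) + F(x) = F(x₁) + F(x₂), contradicting APN, so a pair
-- can be dropped again.  Hence T_r(F) counts the r-tuples in which every value occurs an even
-- number of times.  Appending an entry toggles its membership in the set of values of odd
-- multiplicity, so these are counted by the Ehrenfest-urn recursion
-- c(n+1, k) = k c(n, k-1) + (q-k) c(n, k+1), and T_r(F) = c(r, 0).

module Submission where

open import Defs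
open import Data.Nat using (ℕ; suc; _+_; _*_; _∸_; _^_)
open import Relation.Binary.PropositionalEquality using (_≡_)
open import Data.Product using (_×_)

open import Data.Bool using (Bool; true; false; not; _∧_; _xor_; if_then_else_)
open import Data.Bool.Properties
  using (xor-assoc; xor-comm; xor-identityʳ; xor-same; ∧-conicalʳ; if-float)
  renaming (_≟_ to _≟ᵇ_)
open import Data.Empty using (⊥-elim)
open import Data.List using (List; []; _∷_; [_]; _++_; length; map; concatMap)
open import Data.List.Properties using (map-++; map-cong; map-∘; filter-≐)
open import Data.Nat using (zero; _≤_; _≡ᵇ_; z≤n; s≤s) renaming (_≟_ to _≟ℕ_)
open import Data.Nat.ListAction using (sum)
open import Data.Nat.ListAction.Properties using (sum-++)
open import Data.Nat.Properties
  using ( +-identityʳ; *-identityʳ; *-zeroʳ; *-comm; *-distribˡ-+; *-distribʳ-+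
        ; +-mono-≤; ≤-refl; ≤-trans; *-monoʳ-≤; m^n>0; m+n∸m≡n; m+n∸n≡m
        ; +-commutativeSemigroup; module ≤-Reasoning)
open import Algebra.Properties.CommutativeSemigroup +-commutativeSemigroup using (interchange)
open import Data.Nat.Tactic.RingSolver using (solve)
open import Data.Product using (Σ; _,_)
open import Data.Vec using (Vec; []; _∷_; insertAt; removeAt)
import Data.Vec as Vec
import Data.Fin as Fin
open import Data.Vec.Properties
  using ( ≡-dec; map-id; map-insertAt; insertAt-removeAt
        ; zipWith-assoc; zipWith-comm; zipWith-identityʳ; zipWith-inverseˡ)
open import Data.Vec.Relation.Unary.All using (All; []; _∷_)
import Data.Vec.Relation.Unary.All as All
open import Data.Vec.Relation.Unary.AllPairs using (AllPairs; []; _∷_)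
open import Data.Vec.Relation.Unary.Any using (here; there)
import Data.Vec.Relation.Unary.Any as Any
open import Data.Vec.Relation.Unary.Any.Properties using (lookup-index)
open import Function using (_∘_; id)
open import Level using (0ℓ)
open import Relation.Binary.Definitions using (DecidableEquality)
open import Relation.Binary.PropositionalEquality
  using (refl; sym; trans; cong; cong₂; _≢_; module ≡-Reasoning)
open import Relation.Nullary using (Dec; yes; no; does; ¬_; contradiction)
open import Relation.Nullary.Decidable using (dec-true; dec-false)
open import Relation.Unary using (Pred; Decidable; _≐_)
open import Relation.Unary.Properties using (≐-trans)

record BooleanGroup : Set₁ where
  field
    Carrier   : Set
    _∙_       : Carrier → Carrier → Carrier
    ε         : Carrier
    assoc     : ∀ x y z → (x ∙ y) ∙ z ≡ x ∙ (y ∙ z)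
    comm      : ∀ x y → x ∙ y ≡ y ∙ x
    identityʳ : ∀ x → x ∙ ε ≡ x
    self      : ∀ x → x ∙ x ≡ ε

  open ≡-Reasoning

  cancelˡ : ∀ x y → x ∙ (x ∙ y) ≡ y
  cancelˡ x y = begin
    x ∙ (x ∙ y)  ≡⟨ sym (assoc x x y) ⟩
    (x ∙ x) ∙ y  ≡⟨ cong (_∙ y) (self x) ⟩
    ε ∙ y        ≡⟨ comm ε y ⟩
    y ∙ ε        ≡⟨ identityʳ y ⟩
    y            ∎

  swap : ∀ x y z → x ∙ (y ∙ z) ≡ y ∙ (x ∙ z)
  swap x y z = begin
    x ∙ (y ∙ z)  ≡⟨ sym (assoc x y z) ⟩
    (x ∙ y) ∙ z  ≡⟨ cong (_∙ z) (comm x y) ⟩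
    (y ∙ x) ∙ z  ≡⟨ assoc y x z ⟩
    y ∙ (x ∙ z)  ∎

  ∙≡ε⇒≡ : ∀ {x y} → x ∙ y ≡ ε → x ≡ y
  ∙≡ε⇒≡ {x} {y} x∙y≡ε = begin
    x            ≡⟨ sym (cancelˡ y x) ⟩
    y ∙ (y ∙ x)  ≡⟨ cong (y ∙_) (trans (comm y x) x∙y≡ε) ⟩
    y ∙ ε        ≡⟨ identityʳ y ⟩
    y            ∎

  ⨁ : ∀ {n} → Vec Carrier n → Carrier
  ⨁ = Vec.foldr _ _∙_ ε

  ⨁-insertAt : ∀ {n} (xs : Vec Carrier n) i x → ⨁ (insertAt xs i x) ≡ x ∙ ⨁ xs
  ⨁-insertAt xs       Fin.zero    x = refl
  ⨁-insertAt (y ∷ xs) (Fin.suc i) x = trans (cong (y ∙_) (⨁-insertAt xs i x)) (swap y x (⨁ xs))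

  ⨁-∷-insertAt : ∀ {n} (xs : Vec Carrier n) i x → ⨁ (x ∷ insertAt xs i x) ≡ ⨁ xs
  ⨁-∷-insertAt xs i x = trans (cong (x ∙_) (⨁-insertAt xs i x)) (cancelˡ x (⨁ xs))

  ⨁-pair≡ε⇒≡ : ∀ {x y} → ⨁ (x ∷ y ∷ []) ≡ ε → x ≡ y
  ⨁-pair≡ε⇒≡ {x} {y} ⨁≡ε = ∙≡ε⇒≡ (trans (cong (x ∙_) (sym (identityʳ y))) ⨁≡ε)

  ⨁-quadruple≡ε⇒∙≡∙ : ∀ {a b c d} → ⨁ (a ∷ b ∷ c ∷ d ∷ []) ≡ ε → a ∙ b ≡ c ∙ d
  ⨁-quadruple≡ε⇒∙≡∙ {a} {b} {c} {d} ⨁≡ε = ∙≡ε⇒≡ (begin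
    (a ∙ b) ∙ (c ∙ d)        ≡⟨ assoc a b (c ∙ d) ⟩
    a ∙ (b ∙ (c ∙ d))        ≡⟨ cong (λ z → a ∙ (b ∙ (c ∙ z))) (sym (identityʳ d)) ⟩
    ⨁ (a ∷ b ∷ c ∷ d ∷ [])  ≡⟨ ⨁≡ε ⟩
    ε                        ∎)

  derivative-pair : ∀ (F : Carrier → Carrier) {x y u v} →
                    x ∙ y ≡ u → F x ∙ F y ≡ v → F (y ∙ u) ∙ F y ≡ v
  derivative-pair F {x} {y} x∙y≡u Fx∙Fy≡v = trans (cong (λ z → F z ∙ F y) y∙u≡x) Fx∙Fy≡v
    where
    y∙u≡x : y ∙ _ ≡ x
    y∙u≡x = trans (cong (y ∙_) (trans (sym x∙y≡u) (comm x y))) (cancelˡ y x)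

open BooleanGroup using (Carrier; ε; ⨁)

xor-booleanGroup : BooleanGroup
xor-booleanGroup = record
  { Carrier   = Bool
  ; _∙_       = _xor_
  ; ε         = false
  ; assoc     = xor-assoc
  ; comm      = xor-comm
  ; identityʳ = xor-identityʳ
  ; self      = xor-same
  }

⊕-booleanGroup : ℕ → BooleanGroup
⊕-booleanGroup m = record
  { Carrier   = V m
  ; _∙_       = _⊕_
  ; ε         = 𝟎
  ; assoc     = zipWith-assoc xor-assoc
  ; comm      = zipWith-comm xor-comm
  ; identityʳ = zipWith-identityʳ xor-identityʳ
  ; self      = λ x → trans (cong (_⊕ x) (sym (map-id x))) (zipWith-inverseˡ xor-same x)
  }

⟦_⟧ : Bool → ℕ
⟦ true ⟧  = 1
⟦ false ⟧ = 0

⟦⟧-not : ∀ b → ⟦ b ⟧ + ⟦ not b ⟧ ≡ 1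
⟦⟧-not true  = refl
⟦⟧-not false = refl

⟦⟧-∧ : ∀ b c → ⟦ b ∧ c ⟧ ≡ ⟦ b ⟧ * ⟦ c ⟧
⟦⟧-∧ true  c = sym (+-identityʳ ⟦ c ⟧)
⟦⟧-∧ false c = refl

⟦⟧-xor : ∀ b c → ⟦ b xor c ⟧ + 2 * ⟦ b ∧ c ⟧ ≡ ⟦ b ⟧ + ⟦ c ⟧
⟦⟧-xor true  true  = refl
⟦⟧-xor true  false = refl
⟦⟧-xor false true  = refl
⟦⟧-xor false false = refl

⟦⟧-if : ∀ b (P Q : ℕ) → (if b then P else Q) ≡ ⟦ b ⟧ * P + ⟦ not b ⟧ * Q
⟦⟧-if true  P Q = sym (trans (+-identityʳ _) (+-identityʳ P))
⟦⟧-if false P Q = sym (+-identityʳ Q)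

⟦⟧-mono : ∀ b c → (b ≡ true → c ≡ true) → ⟦ b ⟧ ≤ ⟦ c ⟧
⟦⟧-mono false c _    = z≤n
⟦⟧-mono true  c b⇒c with c | b⇒c refl
... | true | refl = ≤-refl

⟦⟧≤0⇒false : ∀ b → ⟦ b ⟧ ≤ 0 → b ≡ false
⟦⟧≤0⇒false false _ = refl

private
  variable
    A B : Set

∑ : List A → (A → ℕ) → ℕ
∑ L f = sum (map f L)

syntax ∑ L (λ x → e) = ∑[ x ∈ L ] e

∑-cong : ∀ L {f g : A → ℕ} → (∀ x → f x ≡ g x) → ∑ L f ≡ ∑ L g
∑-cong L f≗g = cong sum (map-cong f≗g L)

∑-++ : ∀ L M (f : A → ℕ) → ∑ (L ++ M) f ≡ ∑ L f + ∑ M f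
∑-++ L M f = trans (cong sum (map-++ f L M)) (sum-++ (map f L) (map f M))

∑-+ : ∀ L (f g : A → ℕ) → ∑[ x ∈ L ] (f x + g x) ≡ ∑ L f + ∑ L g
∑-+ []      f g = refl
∑-+ (x ∷ L) f g =
  trans (cong (f x + g x +_) (∑-+ L f g)) (interchange (f x) (g x) (∑ L f) (∑ L g))

∑-*ˡ : ∀ L c (f : A → ℕ) → ∑[ x ∈ L ] (c * f x) ≡ c * ∑ L f
∑-*ˡ []      c f = sym (*-zeroʳ c)
∑-*ˡ (x ∷ L) c f = trans (cong (c * f x +_) (∑-*ˡ L c f)) (sym (*-distribˡ-+ c (f x) (∑ L f)))

∑-*ʳ : ∀ L c (f : A → ℕ) → ∑[ x ∈ L ] (f x * c) ≡ ∑ L f * c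
∑-*ʳ []      c f = refl
∑-*ʳ (x ∷ L) c f = trans (cong (f x * c +_) (∑-*ʳ L c f)) (sym (*-distribʳ-+ c (f x) (∑ L f)))

∑-const : ∀ (L : List A) c → ∑[ _ ∈ L ] c ≡ length L * c
∑-const []      c = refl
∑-const (x ∷ L) c = cong (c +_) (∑-const L c)

∑-ones : ∀ (L : List A) → ∑[ _ ∈ L ] 1 ≡ length L
∑-ones L = trans (∑-const L 1) (*-identityʳ (length L))

∑-mono : ∀ L {f g : A → ℕ} → (∀ x → f x ≤ g x) → ∑ L f ≤ ∑ L g
∑-mono []      f≤g = z≤n
∑-mono (x ∷ L) f≤g = +-mono-≤ (f≤g x) (∑-mono L f≤g)

∑-if : ∀ L (b : A → Bool) P Q →
       ∑[ x ∈ L ] (if b x then P else Q) ≡ ∑[ x ∈ L ] ⟦ b x ⟧ * P + ∑[ x ∈ L ] ⟦ not (b x) ⟧ * Q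
∑-if L b P Q = begin
  ∑[ x ∈ L ] (if b x then P else Q)
    ≡⟨ ∑-cong L (λ x → ⟦⟧-if (b x) P Q) ⟩
  ∑[ x ∈ L ] (⟦ b x ⟧ * P + ⟦ not (b x) ⟧ * Q)
    ≡⟨ ∑-+ L _ _ ⟩
  ∑[ x ∈ L ] (⟦ b x ⟧ * P) + ∑[ x ∈ L ] (⟦ not (b x) ⟧ * Q)
    ≡⟨ cong₂ _+_ (∑-*ʳ L P _) (∑-*ʳ L Q _) ⟩
  ∑[ x ∈ L ] ⟦ b x ⟧ * P + ∑[ x ∈ L ] ⟦ not (b x) ⟧ * Q
    ∎
  where open ≡-Reasoning

∑-map : ∀ (h : A → B) L (f : B → ℕ) → ∑ (map h L) f ≡ ∑[ a ∈ L ] f (h a)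
∑-map h L f = cong sum (sym (map-∘ L))

∑-concatMap : ∀ (h : A → List B) L (f : B → ℕ) → ∑ (concatMap h L) f ≡ ∑[ a ∈ L ] ∑ (h a) f
∑-concatMap h []      f = refl
∑-concatMap h (a ∷ L) f = trans (∑-++ (h a) (concatMap h L) f) (cong (∑ (h a) f +_) (∑-concatMap h L f))

∑-allVecs-suc : ∀ (L : List A) n (f : Vec A (suc n) → ℕ) →
                ∑ (allVecs L (suc n)) f ≡ ∑[ a ∈ L ] ∑[ xs ∈ allVecs L n ] f (a ∷ xs)
∑-allVecs-suc L n f = trans (∑-concatMap (λ a → map (a ∷_) (allVecs L n)) L f)
                            (∑-cong L (λ a → ∑-map (a ∷_) (allVecs L n) f))

count-as-∑ : ∀ {P : Pred A 0ℓ} (P? : Decidable P) L → count P? L ≡ ∑[ x ∈ L ] ⟦ does (P? x) ⟧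
count-as-∑ P? []      = refl
count-as-∑ P? (x ∷ L) with does (P? x)
... | true  = cong suc (count-as-∑ P? L)
... | false = count-as-∑ P? L

IsExactEnumeration : DecidableEquality A → List A → Set
IsExactEnumeration _≟_ L = ∀ a → ∑[ y ∈ L ] ⟦ does (y ≟ a) ⟧ ≡ 1

-- Over a q-letter alphabet, the number of n-letter words whose set of letters of odd
-- multiplicity is a given k-set.
completions : ℕ → ℕ → ℕ → ℕ
completions q zero    zero    = 1
completions q zero    (suc k) = 0
completions q (suc n) k       = k * completions q n (k ∸ 1) + completions q n (suc k) * (q ∸ k)

module Parity {A : Set} (_≟_ : DecidableEquality A) where

  open import Data.Vec.Membership.Propositional using (_∈_; _∉_)
  open import Data.Vec.Membership.DecPropositional _≟_ using (_∈?_)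

  _==_ : A → A → Bool
  x == y = does (x ≟ y)

  odd : ∀ {n} → A → Vec A n → Bool
  odd y xs = ⨁ xor-booleanGroup (Vec.map (y ==_) xs)

  Even : ∀ {n} → Vec A n → Set
  Even xs = ∀ y → odd y xs ≡ false

  record SameSums {n k} (xs : Vec A n) (ys : Vec A k) : Set₁ where
    constructor same-sums
    field ⨁-map≡ : ∀ G (g : A → Carrier G) → ⨁ G (Vec.map g xs) ≡ ⨁ G (Vec.map g ys)

  open SameSums public

  sameSums-sym : ∀ {n k} {xs : Vec A n} {ys : Vec A k} → SameSums xs ys → SameSums ys xs
  sameSums-sym same = same-sums λ G g → sym (⨁-map≡ same G g)

  even-resp-sameSums : ∀ {n k} {xs : Vec A n} {ys : Vec A k} → SameSums xs ys → Even xs → Even ys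
  even-resp-sameSums same even y = trans (sym (⨁-map≡ same xor-booleanGroup (y ==_))) (even y)

  even-pair : ∀ x → Even (x ∷ x ∷ [])
  even-pair x y = BooleanGroup.cancelˡ xor-booleanGroup (y == x) false

  ∉⇒All≢ : ∀ {n x} {xs : Vec A n} → x ∉ xs → All (x ≢_) xs
  ∉⇒All≢ {xs = []}     x∉xs = []
  ∉⇒All≢ {xs = _ ∷ _} x∉xs = (x∉xs ∘ here) ∷ ∉⇒All≢ (x∉xs ∘ there)

  All≢⇒odd≡false : ∀ {n y} {xs : Vec A n} → All (y ≢_) xs → odd y xs ≡ false
  All≢⇒odd≡false []                        = refl
  All≢⇒odd≡false {y = y} {x ∷ _} (y≢x ∷ ps) =
    cong₂ _xor_ (dec-false (y ≟ x) y≢x) (All≢⇒odd≡false ps)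

  odd≡true⇒∈ : ∀ {n y} {xs : Vec A n} → odd y xs ≡ true → y ∈ xs
  odd≡true⇒∈ {y = y} {xs} odd≡true with y ∈? xs
  ... | yes y∈xs = y∈xs
  ... | no  y∉xs = contradiction (trans (sym odd≡true) (All≢⇒odd≡false (∉⇒All≢ y∉xs))) λ ()

  even⇒repeated : ∀ {n x} {xs : Vec A n} → Even (x ∷ xs) → ¬ AllPairs _≢_ (x ∷ xs)
  even⇒repeated {x = x} {xs} even (x∉xs ∷ _) = contradiction (trans (sym (even x)) odd≡true) λ ()
    where
    odd≡true : odd x (x ∷ xs) ≡ true
    odd≡true = cong₂ _xor_ (dec-true (x ≟ x) refl) (All≢⇒odd≡false x∉xs)

  member-cancels : ∀ {n x} {xs : Vec A (suc n)} (x∈xs : x ∈ xs) →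
                   SameSums (x ∷ xs) (removeAt xs (Any.index x∈xs))
  member-cancels {x = x} {xs} x∈xs = same-sums λ G g → begin
      ⨁ G (g x ∷ Vec.map g xs)
    ≡⟨ cong (λ zs → ⨁ G (g x ∷ Vec.map g zs)) (sym xs≡) ⟩
      ⨁ G (g x ∷ Vec.map g (insertAt ys i x))
    ≡⟨ cong (λ zs → ⨁ G (g x ∷ zs)) (map-insertAt g x ys i) ⟩
      ⨁ G (g x ∷ insertAt (Vec.map g ys) i (g x))
    ≡⟨ BooleanGroup.⨁-∷-insertAt G (Vec.map g ys) i (g x) ⟩
      ⨁ G (Vec.map g ys)
    ∎
    where
    open ≡-Reasoning
    i  = Any.index x∈xs
    ys = removeAt xs i
    xs≡ : insertAt ys i x ≡ xs
    xs≡ = trans (cong (insertAt ys i) (lookup-index x∈xs)) (insertAt-removeAt xs i)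

  sameSums-∷ : ∀ {n k} x {xs : Vec A n} {ys : Vec A k} → SameSums xs ys → SameSums (x ∷ xs) (x ∷ ys)
  sameSums-∷ x same = same-sums λ G g → cong (BooleanGroup._∙_ G (g x)) (⨁-map≡ same G g)

  drop-repeated : ∀ {n} (xs : Vec A (2 + n)) → ¬ AllPairs _≢_ xs → Σ (Vec A n) (SameSums xs)
  drop-repeated (x ∷ xs) repeated with x ∈? xs
  ... | yes x∈xs = removeAt xs (Any.index x∈xs) , member-cancels x∈xs
  drop-repeated {zero}  (x ∷ _ ∷ []) repeated | no x∉xs = ⊥-elim (repeated (∉⇒All≢ x∉xs ∷ [] ∷ []))
  drop-repeated {suc n} (x ∷ xs)     repeated | no x∉xs =
    let ys , same = drop-repeated xs (repeated ∘ (∉⇒All≢ x∉xs ∷_))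
    in  x ∷ ys , sameSums-∷ x same

  even⇒⨁≡ε : ∀ {n} (xs : Vec A n) → Even xs → ∀ G (g : A → Carrier G) → ⨁ G (Vec.map g xs) ≡ ε G
  even⇒⨁≡ε []           even G g = refl
  even⇒⨁≡ε (x ∷ [])     even G g = ⊥-elim (even⇒repeated even ([] ∷ []))
  even⇒⨁≡ε (x ∷ y ∷ xs) even G g =
    let ys , same = drop-repeated (x ∷ y ∷ xs) (even⇒repeated even)
    in  trans (⨁-map≡ same G g) (even⇒⨁≡ε ys (even-resp-sameSums same even) G g)

  module Counting (L : List A) (exact : IsExactEnumeration _≟_ L) where

    q : ℕ
    q = length L

    size : (A → Bool) → ℕ
    size f = ∑[ y ∈ L ] ⟦ f y ⟧

    toggle : A → (A → Bool) → A → Bool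
    toggle a f y = (y == a) xor f y

    size-cong : ∀ {f g : A → Bool} → (∀ y → f y ≡ g y) → size f ≡ size g
    size-cong f≗g = ∑-cong L (cong ⟦_⟧ ∘ f≗g)

    size-false : size (λ _ → false) ≡ 0
    size-false = trans (∑-const L 0) (*-zeroʳ (length L))

    size-mono : ∀ {f g : A → Bool} → (∀ y → f y ≡ true → g y ≡ true) → size f ≤ size g
    size-mono {f} {g} f⇒g = ∑-mono L (λ y → ⟦⟧-mono (f y) (g y) (f⇒g y))

    size-not : ∀ (f : A → Bool) → size (not ∘ f) ≡ length L ∸ size f
    size-not f = trans (sym (m+n∸m≡n (size f) _)) (cong (_∸ size f) (begin
      size f + size (not ∘ f)              ≡⟨ sym (∑-+ L _ _) ⟩
      ∑[ y ∈ L ] (⟦ f y ⟧ + ⟦ not (f y) ⟧)  ≡⟨ ∑-cong L (⟦⟧-not ∘ f) ⟩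
      ∑[ _ ∈ L ] 1                          ≡⟨ ∑-ones L ⟩
      length L                              ∎))
      where open ≡-Reasoning

    size-xor : ∀ (f g : A → Bool) →
               size (λ y → f y xor g y) + 2 * size (λ y → f y ∧ g y) ≡ size f + size g
    size-xor f g = begin
      size (λ y → f y xor g y) + 2 * size (λ y → f y ∧ g y)
        ≡⟨ cong (size (λ y → f y xor g y) +_) (sym (∑-*ˡ L 2 _)) ⟩
      size (λ y → f y xor g y) + ∑[ y ∈ L ] (2 * ⟦ f y ∧ g y ⟧)
        ≡⟨ sym (∑-+ L _ _) ⟩
      ∑[ y ∈ L ] (⟦ f y xor g y ⟧ + 2 * ⟦ f y ∧ g y ⟧)
        ≡⟨ ∑-cong L (λ y → ⟦⟧-xor (f y) (g y)) ⟩
      ∑[ y ∈ L ] (⟦ f y ⟧ + ⟦ g y ⟧)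
        ≡⟨ ∑-+ L _ _ ⟩
      size f + size g
        ∎
      where open ≡-Reasoning

    size-singleton-∧ : ∀ a (f : A → Bool) → size (λ y → (y == a) ∧ f y) ≡ ⟦ f a ⟧
    size-singleton-∧ a f = begin
      ∑[ y ∈ L ] ⟦ (y == a) ∧ f y ⟧    ≡⟨ ∑-cong L (λ y → sift (y ≟ a)) ⟩
      ∑[ y ∈ L ] (⟦ f a ⟧ * ⟦ y == a ⟧) ≡⟨ ∑-*ˡ L ⟦ f a ⟧ _ ⟩
      ⟦ f a ⟧ * ∑[ y ∈ L ] ⟦ y == a ⟧   ≡⟨ cong (⟦ f a ⟧ *_) (exact a) ⟩
      ⟦ f a ⟧ * 1                       ≡⟨ *-identityʳ ⟦ f a ⟧ ⟩
      ⟦ f a ⟧                           ∎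
      where
      open ≡-Reasoning
      sift : ∀ {y} (y≟a : Dec (y ≡ a)) → ⟦ does y≟a ∧ f y ⟧ ≡ ⟦ f a ⟧ * ⟦ does y≟a ⟧
      sift (yes refl) = sym (*-identityʳ ⟦ f a ⟧)
      sift (no _)     = sym (*-zeroʳ ⟦ f a ⟧)

    size-toggle : ∀ a (f : A → Bool) → size (toggle a f) ≡ (if f a then size f ∸ 1 else suc (size f))
    size-toggle a f = subtract-2⟦⟧ (f a) (begin
        size (toggle a f) + 2 * ⟦ f a ⟧
      ≡⟨ cong (λ n → size (toggle a f) + 2 * n) (sym (size-singleton-∧ a f)) ⟩
        size (toggle a f) + 2 * size (λ y → (y == a) ∧ f y)
      ≡⟨ size-xor (_== a) f ⟩
        size (_== a) + size f
      ≡⟨ cong (_+ size f) (exact a) ⟩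
        suc (size f)
      ∎)
      where
      open ≡-Reasoning
      subtract-2⟦⟧ : ∀ b {s k} → s + 2 * ⟦ b ⟧ ≡ suc k → s ≡ (if b then k ∸ 1 else suc k)
      subtract-2⟦⟧ true  {s} s+2≡1+k = trans (sym (m+n∸n≡m s 2)) (cong (_∸ 2) s+2≡1+k)
      subtract-2⟦⟧ false {s} s+0≡1+k = trans (sym (+-identityʳ s)) s+0≡1+k

    size≡0⇒false : ∀ {f : A → Bool} → size f ≡ 0 → ∀ y → f y ≡ false
    size≡0⇒false {f} size≡0 y = ⟦⟧≤0⇒false (f y) (begin
      ⟦ f y ⟧                          ≡⟨ sym (size-singleton-∧ y f) ⟩
      size (λ z → (z == y) ∧ f z)      ≤⟨ size-mono (λ z → ∧-conicalʳ (z == y) (f z)) ⟩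
      size f                           ≡⟨ size≡0 ⟩
      0                                ∎)
      where open ≤-Reasoning

    size-odd-distinct : ∀ {n} {xs : Vec A n} → AllPairs _≢_ xs → size (λ y → odd y xs) ≡ n
    size-odd-distinct []                                 = size-false
    size-odd-distinct {xs = x ∷ xs} (x∉xs ∷ distinct) with size-toggle x (λ y → odd y xs)
    ... | size≡ rewrite All≢⇒odd≡false x∉xs = trans size≡ (cong suc (size-odd-distinct distinct))

    distinct⇒≤count : ∀ {n} {P : Pred A 0ℓ} (P? : Decidable P) {xs : Vec A n} →
                      AllPairs _≢_ xs → All P xs → n ≤ count P? L
    distinct⇒≤count {n} P? {xs} distinct all = begin
      n                              ≡⟨ sym (size-odd-distinct distinct) ⟩
      size (λ y → odd y xs)          ≤⟨ size-mono (λ y → dec-true (P? y) ∘ All.lookup all ∘ odd≡true⇒∈) ⟩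
      size (λ y → does (P? y))       ≡⟨ sym (count-as-∑ P? L) ⟩
      count P? L                     ∎
      where open ≤-Reasoning

    completions-toggle : ∀ n a (f : A → Bool) →
      completions q n (size (toggle a f))
        ≡ (if f a then completions q n (size f ∸ 1) else completions q n (suc (size f)))
    completions-toggle n a f =
      trans (cong (completions q n) (size-toggle a f)) (if-float (completions q n) (f a))

    -- size (λ y → f y xor odd y xs) ≡ 0 says that f is exactly the set of values of odd
    -- multiplicity in xs.
    ∑-completing : ∀ n (f : A → Bool) →
      ∑[ xs ∈ allVecs L n ] ⟦ size (λ y → f y xor odd y xs) ≡ᵇ 0 ⟧ ≡ completions q n (size f)
    ∑-completing zero f =
      trans (cong (λ k → ⟦ k ≡ᵇ 0 ⟧ + 0) (size-cong (xor-identityʳ ∘ f))) (base (size f))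
      where
      base : ∀ k → ⟦ k ≡ᵇ 0 ⟧ + 0 ≡ completions q 0 k
      base zero    = refl
      base (suc k) = refl
    ∑-completing (suc n) f = begin
      ∑[ xs ∈ allVecs L (suc n) ] ⟦ size (λ y → f y xor odd y xs) ≡ᵇ 0 ⟧
        ≡⟨ ∑-allVecs-suc L n _ ⟩
      ∑[ a ∈ L ] ∑[ xs ∈ allVecs L n ] ⟦ size (λ y → f y xor ((y == a) xor odd y xs)) ≡ᵇ 0 ⟧
        ≡⟨ ∑-cong L (λ a → ∑-cong (allVecs L n) (λ xs →
             cong (λ k → ⟦ k ≡ᵇ 0 ⟧) (size-cong (λ y → regroup (f y) (y == a) (odd y xs))))) ⟩
      ∑[ a ∈ L ] ∑[ xs ∈ allVecs L n ] ⟦ size (λ y → toggle a f y xor odd y xs) ≡ᵇ 0 ⟧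
        ≡⟨ ∑-cong L (λ a → ∑-completing n (toggle a f)) ⟩
      ∑[ a ∈ L ] completions q n (size (toggle a f))
        ≡⟨ ∑-cong L (λ a → completions-toggle n a f) ⟩
      ∑[ a ∈ L ] (if f a then P else Q)
        ≡⟨ ∑-if L f P Q ⟩
      size f * P + size (not ∘ f) * Q
        ≡⟨ cong (λ s → size f * P + s * Q) (size-not f) ⟩
      size f * P + (q ∸ size f) * Q
        ≡⟨ cong (size f * P +_) (*-comm (q ∸ size f) Q) ⟩
      completions q (suc n) (size f)
        ∎
      where
      open ≡-Reasoning
      P = completions q n (size f ∸ 1)
      Q = completions q n (suc (size f))
      regroup : ∀ b c d → b xor (c xor d) ≡ (c xor b) xor d
      regroup b c d = trans (sym (xor-assoc b c d)) (cong (_xor d) (xor-comm b c))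

    even≐size≡0 : ∀ {n} → Even {n} ≐ (λ xs → size (λ y → odd y xs) ≡ 0)
    even≐size≡0 = (λ even → trans (size-cong even) size-false) , size≡0⇒false

    count-even : ∀ {n} {P : Pred (Vec A n) 0ℓ} (P? : Decidable P) → P ≐ Even →
                 count P? (allVecs L n) ≡ completions q n 0
    count-even {n} P? P≐Even = begin
      count P? (allVecs L n)
        ≡⟨ cong length (filter-≐ P? even? (≐-trans P≐Even even≐size≡0) (allVecs L n)) ⟩
      count even? (allVecs L n)
        ≡⟨ count-as-∑ even? (allVecs L n) ⟩
      ∑[ xs ∈ allVecs L n ] ⟦ size (λ y → odd y xs) ≡ᵇ 0 ⟧
        ≡⟨ ∑-completing n (λ _ → false) ⟩
      completions q n (size (λ _ → false))
        ≡⟨ cong (completions q n) size-false ⟩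
      completions q n 0
        ∎
      where
      open ≡-Reasoning
      even? : Decidable (λ (xs : Vec A n) → size (λ y → odd y xs) ≡ 0)
      even? xs = size (λ y → odd y xs) ≟ℕ 0

allVecs-exact : ∀ (_≟_ : DecidableEquality A) {L} → IsExactEnumeration _≟_ L →
                ∀ n → IsExactEnumeration (≡-dec _≟_) (allVecs L n)
allVecs-exact _≟_ exact zero    []      = refl
allVecs-exact _≟_ {L} exact (suc n) (b ∷ v) = begin
  ∑[ ys ∈ allVecs L (suc n) ] ⟦ does (≡-dec _≟_ ys (b ∷ v)) ⟧
    ≡⟨ ∑-allVecs-suc L n _ ⟩
  ∑[ c ∈ L ] ∑[ ys ∈ allVecs L n ] ⟦ does (c ≟ b) ∧ does (≡-dec _≟_ ys v) ⟧
    ≡⟨ ∑-cong L (λ c → ∑-cong (allVecs L n) (λ ys → ⟦⟧-∧ (does (c ≟ b)) _)) ⟩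
  ∑[ c ∈ L ] ∑[ ys ∈ allVecs L n ] (⟦ does (c ≟ b) ⟧ * ⟦ does (≡-dec _≟_ ys v) ⟧)
    ≡⟨ ∑-cong L (λ c → trans (∑-*ˡ (allVecs L n) ⟦ does (c ≟ b) ⟧ _)
                             (cong (⟦ does (c ≟ b) ⟧ *_) (allVecs-exact _≟_ {L} exact n v))) ⟩
  ∑[ c ∈ L ] (⟦ does (c ≟ b) ⟧ * 1)
    ≡⟨ ∑-cong L (λ c → *-identityʳ _) ⟩
  ∑[ c ∈ L ] ⟦ does (c ≟ b) ⟧
    ≡⟨ exact b ⟩
  1 ∎
  where open ≡-Reasoning

length-allVecs : ∀ (L : List A) n → length (allVecs L n) ≡ length L ^ n
length-allVecs L zero    = refl
length-allVecs L (suc n) = begin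
  length (allVecs L (suc n))               ≡⟨ sym (∑-ones (allVecs L (suc n))) ⟩
  ∑[ _ ∈ allVecs L (suc n) ] 1             ≡⟨ ∑-allVecs-suc L n _ ⟩
  ∑[ _ ∈ L ] ∑[ _ ∈ allVecs L n ] 1        ≡⟨ ∑-cong L (λ _ → ∑-ones (allVecs L n)) ⟩
  ∑[ _ ∈ L ] length (allVecs L n)          ≡⟨ ∑-const L _ ⟩
  length L * length (allVecs L n)          ≡⟨ cong (length L *_) (length-allVecs L n) ⟩
  length L ^ suc n                         ∎
  where open ≡-Reasoning

allV-exact : ∀ m → IsExactEnumeration _≟V_ (allV m)
allV-exact = allVecs-exact _≟ᵇ_ bits-exact
  where
  bits-exact : IsExactEnumeration _≟ᵇ_ (false ∷ true ∷ [])
  bits-exact false = refl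
  bits-exact true  = refl

-- Each entry unfolds one step of the recursion definitionally; the entries that vanish
-- reduce to 0 by themselves.
private
  module EhrenfestTable (p : ℕ) where

    c₂₀ : completions (2 + p) 2 0 ≡ 2 + p
    c₂₀ = +-identityʳ (2 + p)

    c₃₁ : completions (2 + p) 3 1 ≡ 4 + 3 * p
    c₃₁ = trans (cong (λ c → 1 * c + 2 * (1 + p)) c₂₀) (solve [ p ])

    c₄₀ : completions (2 + p) 4 0 ≡ (2 + p) * (4 + 3 * p)
    c₄₀ = trans (cong (_* (2 + p)) c₃₁) (*-comm (4 + 3 * p) (2 + p))

    c₄₂ : completions (2 + p) 4 2 ≡ 8 + 12 * p
    c₄₂ = trans (cong (λ c → 2 * c + 6 * p) c₃₁) (solve [ p ])

    c₅₁ : completions (2 + p) 5 1 ≡ 16 + 30 * p + 15 * p * p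
    c₅₁ = trans (cong₂ (λ c c′ → 1 * c + c′ * (1 + p)) c₄₀ c₄₂) (solve [ p ])

    c₆₀ : completions (2 + p) 6 0 ≡ (2 + p) + 15 * (2 + p) * (1 + p) + 15 * (2 + p) * (1 + p) * p
    c₆₀ = trans (cong (_* (2 + p)) c₅₁) (solve [ p ])

completions-4-0 : ∀ {q} → 2 ≤ q → completions q 4 0 ≡ 3 * q * q ∸ 2 * q
completions-4-0 (s≤s (s≤s {n = p} z≤n)) = begin
  completions (2 + p) 4 0                            ≡⟨ c₄₀ ⟩
  (2 + p) * (4 + 3 * p)                              ≡⟨ m+n∸n≡m ((2 + p) * (4 + 3 * p)) (2 * (2 + p)) ⟨
  (2 + p) * (4 + 3 * p) + 2 * (2 + p) ∸ 2 * (2 + p)  ≡⟨ cong (_∸ 2 * (2 + p)) expand ⟩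
  3 * (2 + p) * (2 + p) ∸ 2 * (2 + p)                ∎
  where
  open ≡-Reasoning
  open EhrenfestTable p
  expand : (2 + p) * (4 + 3 * p) + 2 * (2 + p) ≡ 3 * (2 + p) * (2 + p)
  expand = solve [ p ]

completions-6-0 : ∀ {q} → 2 ≤ q → completions q 6 0 ≡ q + 15 * q * (q ∸ 1) + 15 * q * (q ∸ 1) * (q ∸ 2)
completions-6-0 (s≤s (s≤s {n = p} z≤n)) = EhrenfestTable.c₆₀ p

module _ {m : ℕ} where

  open Parity (_≟V_ {m})
  open Counting (allV m) (allV-exact m)
  open BooleanGroup (⊕-booleanGroup m)
    using (comm; ∙≡ε⇒≡; ⨁-pair≡ε⇒≡; ⨁-quadruple≡ε⇒∙≡∙; derivative-pair)

  apn⇒zero-sum-quadruple-repeats : ∀ {F : V m → V m} → IsAPN F → (xs : Vec (V m) 4) →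
    vsum xs ≡ 𝟎 → vsum (Vec.map F xs) ≡ 𝟎 → ¬ PairwiseDistinct xs
  apn⇒zero-sum-quadruple-repeats {F} apn (a ∷ b ∷ c ∷ d ∷ []) sum≡𝟎 Fsum≡𝟎
                                 distinct@((a≢b ∷ _) ∷ _) =
    four≰two (≤-trans (distinct⇒≤count solves? distinct solutions) (apn u v (a≢b ∘ ∙≡ε⇒≡)))
    where
    u = a ⊕ b
    v = F a ⊕ F b
    solves? = λ x → (F (x ⊕ u) ⊕ F x) ≟V v
    c⊕d≡u : c ⊕ d ≡ u
    c⊕d≡u = sym (⨁-quadruple≡ε⇒∙≡∙ sum≡𝟎)
    Fc⊕Fd≡v : F c ⊕ F d ≡ v
    Fc⊕Fd≡v = sym (⨁-quadruple≡ε⇒∙≡∙ Fsum≡𝟎)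
    solutions : All (λ x → F (x ⊕ u) ⊕ F x ≡ v) (a ∷ b ∷ c ∷ d ∷ [])
    solutions = derivative-pair F (comm b a) (comm (F b) (F a))
              ∷ derivative-pair F refl refl
              ∷ derivative-pair F (trans (comm d c) c⊕d≡u) (trans (comm (F d) (F c)) Fc⊕Fd≡v)
              ∷ derivative-pair F c⊕d≡u Fc⊕Fd≡v
              ∷ []
    four≰two : ¬ (4 ≤ 2)
    four≰two (s≤s (s≤s ()))

  sameSums⇒vsum≡ : ∀ {n k} {xs : Vec (V m) n} {ys : Vec (V m) k} → SameSums xs ys → vsum xs ≡ vsum ys
  sameSums⇒vsum≡ {xs = xs} {ys} same = begin
    vsum xs               ≡⟨ cong vsum (map-id xs) ⟨
    vsum (Vec.map id xs)  ≡⟨ ⨁-map≡ same (⊕-booleanGroup m) id ⟩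
    vsum (Vec.map id ys)  ≡⟨ cong vsum (map-id ys) ⟩
    vsum ys               ∎
    where open ≡-Reasoning

  even⇒TCond : ∀ {n} (F : V m → V m) {xs : Vec (V m) (suc n)} → Even xs → TCond F xs
  even⇒TCond F {xs@(_ ∷ _)} even =
    trans (cong vsum (sym (map-id xs))) (vanish id) , vanish F , even⇒repeated even
    where
    vanish = even⇒⨁≡ε xs even (⊕-booleanGroup m)

  TCond₄⇒even : ∀ (F : V m → V m) (xs : Vec (V m) 4) → TCond F xs → Even xs
  TCond₄⇒even F xs (sum≡𝟎 , _ , repeated) with drop-repeated xs repeated
  ... | a ∷ b ∷ [] , same with ⨁-pair≡ε⇒≡ (trans (sym (sameSums⇒vsum≡ same)) sum≡𝟎)
  ...   | refl = even-resp-sameSums (sameSums-sym same) (even-pair a)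

  TCond₆⇒even : ∀ {F : V m → V m} → IsAPN F → (xs : Vec (V m) 6) → TCond F xs → Even xs
  TCond₆⇒even {F} apn xs (sum≡𝟎 , Fsum≡𝟎 , repeated) with drop-repeated xs repeated
  ... | ys , same =
    even-resp-sameSums (sameSums-sym same) (TCond₄⇒even F ys (ys-sum≡𝟎 , ys-Fsum≡𝟎 , ys-repeated))
    where
    ys-sum≡𝟎 : vsum ys ≡ 𝟎
    ys-sum≡𝟎 = trans (sym (sameSums⇒vsum≡ same)) sum≡𝟎
    ys-Fsum≡𝟎 : vsum (Vec.map F ys) ≡ 𝟎
    ys-Fsum≡𝟎 = trans (sym (⨁-map≡ same (⊕-booleanGroup m) F)) Fsum≡𝟎
    ys-repeated : ¬ PairwiseDistinct ys
    ys-repeated = apn⇒zero-sum-quadruple-repeats apn ys ys-sum≡𝟎 ys-Fsum≡𝟎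

  TCond₄≐Even : (F : V m → V m) → TCond {r = 4} F ≐ Even
  TCond₄≐Even F = TCond₄⇒even F _ , even⇒TCond F

  TCond₆≐Even : ∀ {F : V m → V m} → IsAPN F → TCond {r = 6} F ≐ Even
  TCond₆≐Even {F} apn = TCond₆⇒even apn _ , even⇒TCond F

lemma3 : (m : ℕ) → (F : V (suc m) → V (suc m)) → IsAPN F →
    let q = 2 ^ suc m in
    (T 4 F ≡ 3 * q * q ∸ 2 * q)
      × (T 6 F ≡ q + 15 * q * (q ∸ 1) + 15 * q * (q ∸ 1) * (q ∸ 2))
lemma3 m F apn =
    trans (T≡completions (TCond₄≐Even F)) (completions-4-0 2≤q)
  , trans (T≡completions (TCond₆≐Even apn)) (completions-6-0 2≤q)
  where
  open Parity _≟V_ using (Even; module Counting)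
  open Counting (allV (suc m)) (allV-exact (suc m)) using (count-even)

  q≡2^[1+m] : length (allV (suc m)) ≡ 2 ^ suc m
  q≡2^[1+m] = length-allVecs (false ∷ true ∷ []) (suc m)

  2≤q : 2 ≤ 2 ^ suc m
  2≤q = *-monoʳ-≤ 2 (m^n>0 2 m)

  T≡completions : ∀ {r} → TCond {r = r} F ≐ Even → T r F ≡ completions (2 ^ suc m) r 0
  T≡completions {r} TCond≐Even =
    trans (count-even (TCond? F) TCond≐Even) (cong (λ q → completions q r 0) q≡2^[1+m])
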